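{- Let $u$ be a positive integer with $u\equiv 3$ or $7\pmod{10}$. Then: (1) $v_2(u^2-1)$ is even if and only if there exists an integer $l\ge1$ such that $u\equiv \pm(2^{2l+1}+(-1)^l)$ or $u\equiv\pm(3\cdot 2^{2l+1}+(-1)^l)\pmod{5\cdot 2^{2l+2}}$. (2) There exists an odd prime $p\equiv 2,3,4\pmod 5$ such that $v_p(u+1)$ or $v_p(u-1)$ is odd if and only if there exist an odd prime $p\equiv 2,3,4\pmod 5$, an integer $l\ge 0$ and an integer $b$ with $p\nmid b$ such that one of the following holds: (2.1) $u=2bp^{2l+1}+1$ and $b\equiv 2,4\pmod 5$ if $p\equiv 4\pmod 5$; $b\equiv (-1)^l,\ (-1)^l\cdot 2\pmod 5$ if $p\equiv 3\pmod 5$; $b\equiv (-1)^l\cdot3,\ (-1)^l\cdot 4\pmod 5$ if $p\equiv 2\pmod 5$; (2.2) $u=2bp^{2l+1}-1$ and $b\equiv 1,3\pmod 5$ if $p\equiv 4\pmod 5$; $b\equiv (-1)^l\cdot 3,\ (-1)^l\cdot 4\pmod 5$ if $p\equiv 3\pmod 5$; $b\equiv (-1)^l,\ (-1)^l\cdot2\pmod 5$ if $p\equiv 2\pmod 5$.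
   Context: For a prime $p$ and a nonzero integer $m$, $v_p(m)$ denotes the exponent of the highest power of $p$ dividing $m$ ($v_p(0)=\infty$). -}

module Defs where

open import Data.Nat as ℕ using (ℕ; suc; _^_)
open import Data.Nat.Divisibility as ℕD using ()
open import Data.Integer as ℤ using (ℤ; +_; _-_)
open import Data.Integer.Divisibility as ℤD using ()
open import Data.Product using (Σ; _×_; ∃)
open import Relation.Binary.PropositionalEquality using (_≡_)
open import Relation.Nullary using (¬_)

IsEven : ℕ → Set
IsEven k = ∃ λ m → k ≡ 2 ℕ.* m

IsOdd : ℕ → Set
IsOdd k = ∃ λ m → k ≡ suc (2 ℕ.* m)

-- v_p(m) = k  :  p^k ∣ m  and  p^(k+1) ∤ m   (m ≠ 0 in all uses)
HasVal : ℕ → ℕ → ℕ → Set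
HasVal p m k = (p ^ k) ℕD.∣ m × ¬ ((p ^ suc k) ℕD.∣ m)

ValEven : ℕ → ℕ → Set
ValEven p m = ∃ λ k → HasVal p m k × IsEven k

ValOdd : ℕ → ℕ → Set
ValOdd p m = ∃ λ k → HasVal p m k × IsOdd k

infix 4 _≡_[mod_]
_≡_[mod_] : ℤ → ℤ → ℕ → Set
a ≡ b [mod n ] = (+ n) ℤD.∣ (a - b)

-- An odd u ≥ 3 can be written u = e + 2^(j+2)·(1 + 2z) with e = ±1;
-- then u² − 1 = 2^(j+3)·(odd), so v₂(u² − 1) = j + 3 is even iff j + 2 = 2l + 1
-- with l ≥ 1.  The four classes of the statement are exactly the classes of
-- cls l e c = e + 2^(2l+1)·(1 + 2c) modulo 5·2^(2l+2) for
-- (e, c) = (s, 0), (−s, −1), (s, 1), (−s, −2), s = (−1)^l, and cls l e z lies in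
-- the class of cls l e c iff z ≡ c (mod 5).  Since 2^(2l+1) ≡ 2s (mod 5), the
-- congruence u ≡ 3, 7 (mod 5) leaves, by a finite check, exactly these choices.  If v_p(u ∓ 1) = 2l + 1 then u ∓ 1 = p^(2l+1)·c with p ∤ c, and c = 2b
-- because u ∓ 1 is even and p is odd; as p^(2l+1) ≡ p·(p²)^l (mod 5), the
-- conditions on b mod 5 follow from u mod 5 by a second finite check.
module Submission where

open import Defs
open import Data.Nat as ℕ using (ℕ; zero; suc; _≤_; _<_; _%_; z≤n; s≤s; z<s; NonZero)
import Data.Nat.Properties as ℕP
open import Data.Nat.Divisibility using (_∣_; divides; _∣?_; ∣⇒≤; ∣1⇒≡1; ∣-trans; ∣m⇒∣m*n; *-cancelˡ-∣)
import Data.Nat.DivMod as ℕDM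
open import Data.Nat.Induction using (<-wellFounded)
open import Data.Nat.Primality using (Prime; euclidsLemma; prime[2]; prime⇒nonZero; prime⇒nonTrivial)
import Data.Nat.Tactic.RingSolver as ℕSolver
open import Data.Integer as ℤ using (ℤ; +_; -_; _-_; _+_; _*_; _^_; 1ℤ; 0ℤ; ∣_∣)
import Data.Integer.Properties as ℤP
import Data.Integer.Divisibility as ℤD
import Data.Integer.Divisibility.Signed as ℤS
open import Data.Integer.Tactic.RingSolver using (solve-∀)
open import Data.List using (List; []; _∷_; map; upTo)
open import Data.List.Membership.Propositional using (_∈_)
open import Data.List.Membership.Propositional.Properties using (∈-map⁺; ∈-upTo⁺)
open import Data.List.Relation.Unary.Any using (here; there)
open import Data.List.Relation.Unary.All as All using (All; all?)
open import Data.Product using (_×_; ∃; ∃₂; _,_; proj₁; proj₂)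
open import Data.Sum using (_⊎_; inj₁; inj₂) renaming (map to map⊎)
open import Function.Bundles using (_⇔_; mk⇔)
open import Induction.WellFounded using (Acc; acc)
open import Level using (0ℓ)
open import Relation.Binary.Bundles using (Setoid)
open import Relation.Binary.Definitions using (tri<; tri≈; tri>)
import Relation.Binary.Reasoning.Setoid as SetoidReasoning
open import Relation.Binary.PropositionalEquality
open import Relation.Nullary using (¬_; Dec; contradiction)
open import Relation.Nullary.Decidable using (_→-dec_; _×-dec_; _⊎-dec_; toWitness)

double-suc : ∀ m → 2 ℕ.* suc m ≡ suc (suc (2 ℕ.* m))
double-suc = ℕSolver.solve-∀

parity : ∀ n → IsEven n ⊎ IsOdd n
parity zero = inj₁ (0 , refl)
parity (suc n) with parity n
... | inj₁ (m , refl) = inj₂ (m , refl)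
... | inj₂ (m , refl) = inj₁ (suc m , sym (double-suc m))

two-adic : ∀ n → 0 < n → ∃₂ λ j o → n ≡ 2 ℕ.^ j ℕ.* suc (2 ℕ.* o)
two-adic n = go n (<-wellFounded n)
  where
  go : ∀ n → Acc _<_ n → 0 < n → ∃₂ λ j o → n ≡ 2 ℕ.^ j ℕ.* suc (2 ℕ.* o)
  go n (acc smaller) n>0 with parity n
  ... | inj₂ (o , n≡) = 0 , o , trans n≡ (sym (ℕP.*-identityˡ _))
  ... | inj₁ (zero , refl) = contradiction n>0 (ℕP.<-irrefl refl)
  ... | inj₁ (suc m , refl) with go (suc m) (smaller (ℕP.m<m+n (suc m) z<s)) z<s
  ...   | j , o , m≡ = suc j , o , trans (cong (2 ℕ.*_) m≡) (sym (ℕP.*-assoc 2 (2 ℕ.^ j) _))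

2∤odd : ∀ {n} → IsOdd n → ¬ 2 ∣ n
2∤odd (m , refl) (divides q eq) = ℕP.even≢odd q m (trans (ℕP.*-comm 2 q) (sym eq))

2∤odd^ : ∀ {p} → IsOdd p → ∀ k → ¬ 2 ∣ p ℕ.^ k
2∤odd^ _ zero 2∣1 = contradiction (∣1⇒≡1 2∣1) λ ()
2∤odd^ p-odd (suc k) 2∣pᵏ⁺¹ with euclidsLemma _ _ prime[2] 2∣pᵏ⁺¹
... | inj₁ 2∣p = 2∤odd p-odd 2∣p
... | inj₂ 2∣pᵏ = 2∤odd^ p-odd k 2∣pᵏ

odd-prime∤2 : ∀ {p} → Prime p → IsOdd p → ¬ p ∣ 2
odd-prime∤2 p-prime (zero , refl) _ with prime⇒nonTrivial p-prime
... | ()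
odd-prime∤2 _ (suc m , refl) p∣2 = ℕP.<⇒≱ (s≤s (ℕP.m≤m*n 2 (suc m))) (∣⇒≤ p∣2)

-- p-adic valuations

^-∣-^ : ∀ p {a b} → a ≤ b → p ℕ.^ a ∣ p ℕ.^ b
^-∣-^ p {a} a≤b with ℕP.m≤n⇒∃[o]m+o≡n a≤b
... | o , refl = divides (p ℕ.^ o) (trans (ℕP.^-distribˡ-+-* p a o) (ℕP.*-comm (p ℕ.^ a) _))

hasVal-unique : ∀ {p m k k′} → HasVal p m k → HasVal p m k′ → k ≡ k′
hasVal-unique {p} {k = k} {k′} (pᵏ∣m , pᵏ⁺¹∤m) (pᵏ′∣m , pᵏ′⁺¹∤m) with ℕP.<-cmp k k′
... | tri< k<k′ _ _ = contradiction (∣-trans (^-∣-^ p k<k′) pᵏ′∣m) pᵏ⁺¹∤m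
... | tri≈ _ k≡k′ _ = k≡k′
... | tri> _ _ k′<k = contradiction (∣-trans (^-∣-^ p k′<k) pᵏ∣m) pᵏ′⁺¹∤m

hasVal-intro : ∀ p k {m c} .{{_ : NonZero p}} → m ≡ p ℕ.^ k ℕ.* c → ¬ p ∣ c → HasVal p m k
hasVal-intro p k {m} {c} m≡ p∤c = divides c (trans m≡ (ℕP.*-comm _ c)) , pᵏ⁺¹∤m
  where
  pᵏ⁺¹∤m : ¬ p ℕ.^ suc k ∣ m
  pᵏ⁺¹∤m h = p∤c (*-cancelˡ-∣ (p ℕ.^ k) {{ℕP.m^n≢0 p k}}
                    (subst₂ _∣_ (ℕP.*-comm p (p ℕ.^ k)) m≡ h))

hasVal-elim : ∀ {p m k} → HasVal p m k → ∃ λ c → m ≡ p ℕ.^ k ℕ.* c × ¬ p ∣ c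
hasVal-elim {p} {k = k} (divides c m≡ , pᵏ⁺¹∤m) = c , trans m≡ (ℕP.*-comm c _) , p∤c
  where
  p∤c : ¬ p ∣ c
  p∤c (divides d c≡) =
    pᵏ⁺¹∤m (divides d (trans m≡ (trans (cong (ℕ._* p ℕ.^ k) c≡) (ℕP.*-assoc d p _))))

pos-^ : ∀ p k → (+ p) ^ k ≡ + (p ℕ.^ k)
pos-^ p zero = refl
pos-^ p (suc k) = trans (cong (+ p *_) (pos-^ p k)) (sym (ℤP.pos-* p (p ℕ.^ k)))

pos-odd : ∀ m → + suc (2 ℕ.* m) ≡ 1ℤ + + 2 * + m
pos-odd m = trans (ℤP.pos-+ 1 (2 ℕ.* m)) (cong (_+_ 1ℤ) (ℤP.pos-* 2 m))

pos-suc : ∀ n → + suc n ≡ + n + 1ℤ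
pos-suc n = trans (cong +_ (ℕP.+-comm 1 n)) (ℤP.pos-+ n 1)

pos-square-pred : ∀ {u} → 0 < u → + (u ℕ.* u ℕ.∸ 1) ≡ + u * + u - 1ℤ
pos-square-pred {suc u} _ = cong (_- 1ℤ) (ℤP.pos-* (suc u) (suc u))

hasVal-introℤ : ∀ p k {m w} .{{_ : NonZero p}} →
                + m ≡ (+ p) ^ k * w → ¬ (+ p) ℤD.∣ w → HasVal p m k
hasVal-introℤ p k {m} {w} m≡ = hasVal-intro p k (begin
  m                        ≡⟨ cong ∣_∣ m≡ ⟩
  ∣ (+ p) ^ k * w ∣        ≡⟨ ℤP.abs-* ((+ p) ^ k) w ⟩
  ∣ (+ p) ^ k ∣ ℕ.* ∣ w ∣  ≡⟨ cong (λ t → ∣ t ∣ ℕ.* ∣ w ∣) (pos-^ p k) ⟩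
  p ℕ.^ k ℕ.* ∣ w ∣        ∎)
  where open ≡-Reasoning

odd-prime∤2b : ∀ {p b} → Prime p → IsOdd p → ¬ (+ p) ℤD.∣ b → ¬ (+ p) ℤD.∣ (+ 2 * b)
odd-prime∤2b {p} {b} p-prime p-odd p∤b p∣2b
  with euclidsLemma 2 ∣ b ∣ p-prime (subst (p ∣_) (ℤP.abs-* (+ 2) b) p∣2b)
... | inj₁ p∣2 = odd-prime∤2 p-prime p-odd p∣2
... | inj₂ p∣b = p∤b p∣b

OddInt : ℤ → Set
OddInt x = ∃ λ w → x ≡ 1ℤ + + 2 * w

odd-* : ∀ {x y} → OddInt x → OddInt y → OddInt (x * y)
odd-* (a , refl) (b , refl) = a + b + + 2 * a * b , product a b
  where
  product : ∀ a b → (1ℤ + + 2 * a) * (1ℤ + + 2 * b) ≡ 1ℤ + + 2 * (a + b + + 2 * a * b)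
  product = solve-∀

odd-+-even : ∀ {x} → OddInt x → ∀ y → OddInt (x + + 2 * y)
odd-+-even (a , refl) y = a + y , shift a y
  where
  shift : ∀ a y → 1ℤ + + 2 * a + + 2 * y ≡ 1ℤ + + 2 * (a + y)
  shift = solve-∀

odd⇒2∤ : ∀ {x} → OddInt x → ¬ (+ 2) ℤD.∣ x
odd⇒2∤ (w , refl) 2∣x = contradiction (∣1⇒≡1 2∣1) λ ()
  where
  2∣1 : 2 ∣ 1
  2∣1 = ℤS.∣⇒∣ᵤ (ℤS.∣m+n∣n⇒∣m {+ 2} {1ℤ} (ℤS.∣ᵤ⇒∣ 2∣x) (ℤS.divides w (ℤP.*-comm (+ 2) w)))

signs : List ℤ
signs = 1ℤ ∷ - 1ℤ ∷ []

sgn : ℕ → ℤ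
sgn l = (- 1ℤ) ^ l

sgn∈signs : ∀ l → sgn l ∈ signs
sgn∈signs zero = here refl
sgn∈signs (suc l) with sgn l | sgn∈signs l
... | _ | here refl = there (here refl)
... | _ | there (here refl) = here refl

sign-odd : ∀ {e} → e ∈ signs → OddInt e
sign-odd (here refl) = 0ℤ , refl
sign-odd (there (here refl)) = - 1ℤ , refl

sign-neg : ∀ {e} → e ∈ signs → - e ∈ signs
sign-neg (here refl) = there (here refl)
sign-neg (there (here refl)) = here refl

sign-square : ∀ {e} → e ∈ signs → e * e ≡ 1ℤ
sign-square (here refl) = refl
sign-square (there (here refl)) = refl

-- x ≡ y [mod n ] wrapped in a record, so that x, y and n can be inferred.
infix 4 _≋[_]_
record _≋[_]_ (x : ℤ) (n : ℕ) (y : ℤ) : Set where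
  constructor mk≋
  field unwrap : x ≡ y [mod n ]
open _≋[_]_ public

module _ {n : ℕ} where

  ≋-intro : ∀ {x y} q → x ≡ y + q * + n → x ≋[ n ] y
  ≋-intro {y = y} q x≡ =
    mk≋ (ℤS.∣⇒∣ᵤ (ℤS.divides q (trans (cong (_- y) x≡) (cancel y (q * + n)))))
    where
    cancel : ∀ a b → a + b - a ≡ b
    cancel = solve-∀

  ≋-elim : ∀ {x y} → x ≋[ n ] y → ∃ λ q → x ≡ y + q * + n
  ≋-elim {x} {y} (mk≋ h) with ℤS.∣ᵤ⇒∣ {+ n} {x - y} h
  ... | ℤS.divides q x-y≡ = q , trans (split x y) (cong (_+_ y) x-y≡)
    where
    split : ∀ a b → a ≡ b + (a - b)
    split = solve-∀

  ≋-refl : ∀ {x} → x ≋[ n ] x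
  ≋-refl {x} = ≋-intro 0ℤ (zero-multiple x (+ n))
    where
    zero-multiple : ∀ x N → x ≡ x + 0ℤ * N
    zero-multiple = solve-∀

  ≋-reflexive : ∀ {x y} → x ≡ y → x ≋[ n ] y
  ≋-reflexive refl = ≋-refl

  ≋-sym : ∀ {x y} → x ≋[ n ] y → y ≋[ n ] x
  ≋-sym {y = y} h with q , refl ← ≋-elim h = ≋-intro (- q) (back y q (+ n))
    where
    back : ∀ y q N → y ≡ y + q * N + - q * N
    back = solve-∀

  ≋-trans : ∀ {x y z} → x ≋[ n ] y → y ≋[ n ] z → x ≋[ n ] z
  ≋-trans {z = z} h k with q , refl ← ≋-elim h | r , refl ← ≋-elim k =
    ≋-intro (r + q) (combine z q r (+ n))
    where
    combine : ∀ z q r N → z + r * N + q * N ≡ z + (r + q) * N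
    combine = solve-∀

  ≋-+ : ∀ {x y u v} → x ≋[ n ] y → u ≋[ n ] v → x + u ≋[ n ] y + v
  ≋-+ {y = y} {v = v} h k with q , refl ← ≋-elim h | r , refl ← ≋-elim k =
    ≋-intro (q + r) (combine y v q r (+ n))
    where
    combine : ∀ y v q r N → y + q * N + (v + r * N) ≡ y + v + (q + r) * N
    combine = solve-∀

  ≋-* : ∀ {x y u v} → x ≋[ n ] y → u ≋[ n ] v → x * u ≋[ n ] y * v
  ≋-* {y = y} {v = v} h k with q , refl ← ≋-elim h | r , refl ← ≋-elim k =
    ≋-intro (q * v + y * r + q * r * + n) (combine y v q r (+ n))
    where
    combine : ∀ y v q r N → (y + q * N) * (v + r * N) ≡ y * v + (q * v + y * r + q * r * N) * N
    combine = solve-∀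

  ≋-+ˡ : ∀ a {x y} → x ≋[ n ] y → a + x ≋[ n ] a + y
  ≋-+ˡ a = ≋-+ (≋-refl {a})

  ≋-+ʳ : ∀ a {x y} → x ≋[ n ] y → x + a ≋[ n ] y + a
  ≋-+ʳ a h = ≋-+ h (≋-refl {a})

  ≋-*ˡ : ∀ a {x y} → x ≋[ n ] y → a * x ≋[ n ] a * y
  ≋-*ˡ a = ≋-* (≋-refl {a})

  ≋-^ : ∀ {x y} k → x ≋[ n ] y → x ^ k ≋[ n ] y ^ k
  ≋-^ zero _ = ≋-refl
  ≋-^ (suc k) h = ≋-* h (≋-^ k h)

≋-setoid : ℕ → Setoid 0ℓ 0ℓ
≋-setoid n = record
  { Carrier = ℤ
  ; _≈_ = λ x y → x ≋[ n ] y
  ; isEquivalence = record { refl = ≋-refl ; sym = ≋-sym ; trans = ≋-trans }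
  }

module ≋-Reasoning (n : ℕ) = SetoidReasoning (≋-setoid n)

≋-% : ∀ n o .{{_ : NonZero n}} → + o ≋[ n ] + (o % n)
≋-% n o = ≋-intro (+ (o ℕ./ n)) (begin
  + o                                ≡⟨ cong +_ (ℕDM.m≡m%n+[m/n]*n o n) ⟩
  + (o % n ℕ.+ o ℕ./ n ℕ.* n)        ≡⟨ ℤP.pos-+ (o % n) _ ⟩
  + (o % n) + + (o ℕ./ n ℕ.* n)      ≡⟨ cong (_+_ (+ (o % n))) (ℤP.pos-* (o ℕ./ n) n) ⟩
  + (o % n) + + (o ℕ./ n) * + n      ∎)
  where open ≡-Reasoning

≋-weaken : ∀ {d n x y} → d ∣ n → x ≋[ n ] y → x ≋[ d ] y
≋-weaken {d} {y = y} (divides k refl) h with q , refl ← ≋-elim h =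
  ≋-intro (q * + k) (trans (cong (λ t → y + q * t) (ℤP.pos-* k d)) (regroup y q (+ k) (+ d)))
  where
  regroup : ∀ y q K D → y + q * (K * D) ≡ y + q * K * D
  regroup = solve-∀

_≡?_[mod_] : ∀ x y n → Dec (x ≡ y [mod n ])
x ≡? y [mod n ] = n ∣? ∣ x - y ∣

-- Odd powers modulo 5

odd-power : ∀ {n x t} l → x * x ≋[ n ] t → x ^ (2 ℕ.* l ℕ.+ 1) ≋[ n ] t ^ l * x
odd-power {x = x} zero _ = ≋-reflexive (ℤP.*-comm x 1ℤ)
odd-power {n} {x} {t} (suc l) x²≋t = begin
  x ^ (2 ℕ.* suc l ℕ.+ 1)        ≡⟨ cong (x ^_) (step l) ⟩
  x * (x * x ^ (2 ℕ.* l ℕ.+ 1))  ≡⟨ ℤP.*-assoc x x _ ⟨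
  x * x * x ^ (2 ℕ.* l ℕ.+ 1)    ≈⟨ ≋-* x²≋t (odd-power l x²≋t) ⟩
  t * (t ^ l * x)                ≡⟨ ℤP.*-assoc t (t ^ l) x ⟨
  t ^ suc l * x                  ∎
  where
  open ≋-Reasoning n
  step : ∀ l → 2 ℕ.* suc l ℕ.+ 1 ≡ 2 ℕ.+ (2 ℕ.* l ℕ.+ 1)
  step = ℕSolver.solve-∀

πs : List ℕ
πs = 2 ∷ 3 ∷ 4 ∷ []

-- p^(2l+1) mod 5 for p ≡ π (mod 5): as 2² ≡ 3² ≡ −1 and 4² ≡ 1, it is (−1)^l·π
-- unless π = 4, when it is 4.
oddPowRes : ℕ → ℤ → ℤ
oddPowRes 4 s = + 4
oddPowRes π s = s * + π

odd-power-mod5 : ∀ {x π} l → π ∈ πs → x ≋[ 5 ] + π →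
                 x ^ (2 ℕ.* l ℕ.+ 1) ≋[ 5 ] oddPowRes π (sgn l)
odd-power-mod5 l π∈ x≋π = ≋-trans (≋-^ (2 ℕ.* l ℕ.+ 1) x≋π) (by-residue π∈)
  where
  by-residue : ∀ {π} → π ∈ πs → (+ π) ^ (2 ℕ.* l ℕ.+ 1) ≋[ 5 ] oddPowRes π (sgn l)
  by-residue (here refl) = odd-power l (≋-intro 1ℤ refl)
  by-residue (there (here refl)) = odd-power l (≋-intro (+ 2) refl)
  by-residue (there (there (here refl))) =
    ≋-trans (odd-power l (≋-intro (+ 3) refl)) (≋-reflexive (cong (_* + 4) (ℤP.^-zeroˡ l)))

odd-of-residue : ∀ {u} → u % 10 ≡ 3 ⊎ u % 10 ≡ 7 → ∃ λ m → 0 < m × u ≡ suc (2 ℕ.* m)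
odd-of-residue {u} (inj₁ r≡3) = suc (5 ℕ.* (u ℕ./ 10)) , z<s ,
  trans (ℕDM.m≡m%n+[m/n]*n u 10) (trans (cong (ℕ._+ u ℕ./ 10 ℕ.* 10) r≡3) (regroup (u ℕ./ 10)))
  where
  regroup : ∀ q → 3 ℕ.+ q ℕ.* 10 ≡ suc (2 ℕ.* suc (5 ℕ.* q))
  regroup = ℕSolver.solve-∀
odd-of-residue {u} (inj₂ r≡7) = 3 ℕ.+ 5 ℕ.* (u ℕ./ 10) , z<s ,
  trans (ℕDM.m≡m%n+[m/n]*n u 10) (trans (cong (ℕ._+ u ℕ./ 10 ℕ.* 10) r≡7) (regroup (u ℕ./ 10)))
  where
  regroup : ∀ q → 7 ℕ.+ q ℕ.* 10 ≡ suc (2 ℕ.* (3 ℕ.+ 5 ℕ.* q))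
  regroup = ℕSolver.solve-∀

uResidues : List ℤ
uResidues = + 3 ∷ + 7 ∷ []

residue-mod5 : ∀ {u} → u % 10 ≡ 3 ⊎ u % 10 ≡ 7 → ∃ λ r → r ∈ uResidues × + u ≋[ 5 ] r
residue-mod5 {u} (inj₁ r≡3) =
  + 3 , here refl , subst (λ t → + u ≋[ 5 ] + t) r≡3 (≋-weaken (divides 2 refl) (≋-% 10 u))
residue-mod5 {u} (inj₂ r≡7) =
  + 7 , there (here refl) , subst (λ t → + u ≋[ 5 ] + t) r≡7 (≋-weaken (divides 2 refl) (≋-% 10 u))

odd-split : ∀ m → 0 < m → ∃ λ e → e ∈ signs × ∃ λ k → 0 < k × + suc (2 ℕ.* m) ≡ e + + 4 * + k
odd-split m m>0 with parity m
... | inj₁ (zero , refl) = contradiction m>0 (ℕP.<-irrefl refl)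
... | inj₁ (suc k , refl) = 1ℤ , here refl , suc k , z<s , (begin
  + suc (2 ℕ.* (2 ℕ.* suc k))    ≡⟨ pos-odd (2 ℕ.* suc k) ⟩
  1ℤ + + 2 * + (2 ℕ.* suc k)     ≡⟨ cong (λ t → 1ℤ + + 2 * t) (ℤP.pos-* 2 (suc k)) ⟩
  1ℤ + + 2 * (+ 2 * + suc k)     ≡⟨ regroup (+ suc k) ⟩
  1ℤ + + 4 * + suc k             ∎)
  where
  open ≡-Reasoning
  regroup : ∀ K → 1ℤ + + 2 * (+ 2 * K) ≡ 1ℤ + + 4 * K
  regroup = solve-∀
... | inj₂ (k , refl) = - 1ℤ , there (here refl) , suc k , z<s , (begin
  + suc (2 ℕ.* suc (2 ℕ.* k))    ≡⟨ pos-odd (suc (2 ℕ.* k)) ⟩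
  1ℤ + + 2 * + suc (2 ℕ.* k)     ≡⟨ cong (λ t → 1ℤ + + 2 * t) (pos-odd k) ⟩
  1ℤ + + 2 * (1ℤ + + 2 * + k)    ≡⟨ regroup (+ k) ⟩
  - 1ℤ + + 4 * (1ℤ + + k)        ≡⟨ cong (λ t → - 1ℤ + + 4 * t) (ℤP.pos-+ 1 k) ⟨
  - 1ℤ + + 4 * + suc k           ∎)
  where
  open ≡-Reasoning
  regroup : ∀ K → 1ℤ + + 2 * (1ℤ + + 2 * K) ≡ - 1ℤ + + 4 * (1ℤ + K)
  regroup = solve-∀

near-sign : ∀ {u} → u % 10 ≡ 3 ⊎ u % 10 ≡ 7 →
            ∃ λ e → e ∈ signs × ∃₂ λ j o → + u ≡ e + (+ 2) ^ (2 ℕ.+ j) * (1ℤ + + 2 * + o)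
near-sign {u} h10 with odd-of-residue {u} h10
... | m , m>0 , refl with odd-split m m>0
...   | e , e∈ , k , k>0 , u≡ with two-adic k k>0
...     | j , o , refl = e , e∈ , j , o , trans u≡ (cong (_+_ e) (begin
  + 4 * + (2 ℕ.^ j ℕ.* suc (2 ℕ.* o))           ≡⟨ cong (+ 4 *_) (ℤP.pos-* (2 ℕ.^ j) _) ⟩
  + 4 * (+ (2 ℕ.^ j) * + suc (2 ℕ.* o))        ≡⟨ cong₂ (λ a b → + 4 * (a * b)) (sym (pos-^ 2 j)) (pos-odd o) ⟩
  + 4 * ((+ 2) ^ j * (1ℤ + + 2 * + o))         ≡⟨ regroup ((+ 2) ^ j) (+ o) ⟩
  (+ 2) ^ (2 ℕ.+ j) * (1ℤ + + 2 * + o)         ∎))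
  where
  open ≡-Reasoning
  regroup : ∀ P O → + 4 * (P * (1ℤ + + 2 * O)) ≡ + 2 * (+ 2 * P) * (1ℤ + + 2 * O)
  regroup = solve-∀

v₂-square-minus-one : ∀ {u e} j z → 0 < u → e ∈ signs →
                      + u ≡ e + (+ 2) ^ (2 ℕ.+ j) * (1ℤ + + 2 * z) →
                      HasVal 2 (u ℕ.* u ℕ.∸ 1) (3 ℕ.+ j)
v₂-square-minus-one {u} {e} j z u>0 e∈ u≡ = hasVal-introℤ 2 (3 ℕ.+ j) u²-1≡ (odd⇒2∤ w-odd)
  where
  open ≡-Reasoning
  P o w : ℤ
  P = (+ 2) ^ j
  o = 1ℤ + + 2 * z
  w = o * (e + + 2 * (P * o))

  w-odd : OddInt w
  w-odd = odd-* (z , refl) (odd-+-even (sign-odd e∈) (P * o))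

  expand : ∀ e P o → (e + + 2 * (+ 2 * P) * o) * (e + + 2 * (+ 2 * P) * o) - 1ℤ
                     ≡ e * e - 1ℤ + + 2 * (+ 2 * (+ 2 * P)) * (o * (e + + 2 * (P * o)))
  expand = solve-∀

  u²-1≡ : + (u ℕ.* u ℕ.∸ 1) ≡ (+ 2) ^ (3 ℕ.+ j) * w
  u²-1≡ = begin
    + (u ℕ.* u ℕ.∸ 1)                    ≡⟨ pos-square-pred u>0 ⟩
    + u * + u - 1ℤ                        ≡⟨ cong (λ t → t * t - 1ℤ) u≡ ⟩
    (e + (+ 2) ^ (2 ℕ.+ j) * o) * (e + (+ 2) ^ (2 ℕ.+ j) * o) - 1ℤ
                                          ≡⟨ expand e P o ⟩
    e * e - 1ℤ + (+ 2) ^ (3 ℕ.+ j) * w    ≡⟨ cong (λ t → t - 1ℤ + (+ 2) ^ (3 ℕ.+ j) * w) (sign-square e∈) ⟩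
    0ℤ + (+ 2) ^ (3 ℕ.+ j) * w            ≡⟨ ℤP.+-identityˡ _ ⟩
    (+ 2) ^ (3 ℕ.+ j) * w                 ∎

-- Part (1)

modulus : ℕ → ℕ
modulus l = 5 ℕ.* 2 ℕ.^ (2 ℕ.* l ℕ.+ 2)

repA repB : ℕ → ℤ
repA l = (+ 2) ^ (2 ℕ.* l ℕ.+ 1) + sgn l
repB l = + 3 * (+ 2) ^ (2 ℕ.* l ℕ.+ 1) + sgn l

InClasses : ℕ → ℕ → Set
InClasses u l = (+ u ≡ repA l [mod modulus l ] ⊎ + u ≡ - repA l [mod modulus l ])
              ⊎ (+ u ≡ repB l [mod modulus l ] ⊎ + u ≡ - repB l [mod modulus l ])

-- cls l e c = e + 2^(2l+1)·(1 + 2c); every class of part (1) is the class of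
-- some cls l e c modulo 5·2^(2l+2) = 10·2^(2l+1).
cls : ℕ → ℤ → ℤ → ℤ
cls l e c = e + (+ 2) ^ (2 ℕ.* l ℕ.+ 1) * (1ℤ + + 2 * c)

modulus-split : ∀ l → + modulus l ≡ + 5 * (+ 2 * (+ 2) ^ (2 ℕ.* l ℕ.+ 1))
modulus-split l = begin
  + (5 ℕ.* 2 ℕ.^ (2 ℕ.* l ℕ.+ 2))         ≡⟨ ℤP.pos-* 5 (2 ℕ.^ (2 ℕ.* l ℕ.+ 2)) ⟩
  + 5 * + (2 ℕ.^ (2 ℕ.* l ℕ.+ 2))         ≡⟨ cong (+ 5 *_) (pos-^ 2 (2 ℕ.* l ℕ.+ 2)) ⟨
  + 5 * (+ 2) ^ (2 ℕ.* l ℕ.+ 2)           ≡⟨ cong (λ k → + 5 * (+ 2) ^ k) (ℕP.+-suc (2 ℕ.* l) 1) ⟩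
  + 5 * (+ 2 * (+ 2) ^ (2 ℕ.* l ℕ.+ 1))   ∎
  where open ≡-Reasoning

cls-step : ∀ l e c q → cls l e (c + q * + 5) ≡ cls l e c + q * + modulus l
cls-step l e c q = trans (shift e ((+ 2) ^ (2 ℕ.* l ℕ.+ 1)) c q)
                         (cong (λ t → cls l e c + q * t) (sym (modulus-split l)))
  where
  shift : ∀ e N c q → e + N * (1ℤ + + 2 * (c + q * + 5))
                      ≡ e + N * (1ℤ + + 2 * c) + q * (+ 5 * (+ 2 * N))
  shift = solve-∀

cls-congruent : ∀ l e {z c} → z ≋[ 5 ] c → cls l e z ≡ cls l e c [mod modulus l ]
cls-congruent l e {c = c} z≋c with q , refl ← ≋-elim z≋c = unwrap (≋-intro q (cls-step l e c q))

cls-shift : ∀ l e c {x} → x ≡ cls l e c [mod modulus l ] → ∃ λ z → x ≡ cls l e z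
cls-shift l e c h with q , x≡ ← ≋-elim (mk≋ h) = c + q * + 5 , trans x≡ (sym (cls-step l e c q))

repA-cls : ∀ l → repA l ≡ cls l (sgn l) 0ℤ
repA-cls l = rewrite-as (sgn l) ((+ 2) ^ (2 ℕ.* l ℕ.+ 1))
  where
  rewrite-as : ∀ s N → N + s ≡ s + N * (1ℤ + + 2 * 0ℤ)
  rewrite-as = solve-∀

neg-repA-cls : ∀ l → - repA l ≡ cls l (- sgn l) (- 1ℤ)
neg-repA-cls l = rewrite-as (sgn l) ((+ 2) ^ (2 ℕ.* l ℕ.+ 1))
  where
  rewrite-as : ∀ s N → - (N + s) ≡ - s + N * (1ℤ + + 2 * - 1ℤ)
  rewrite-as = solve-∀

repB-cls : ∀ l → repB l ≡ cls l (sgn l) 1ℤ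
repB-cls l = rewrite-as (sgn l) ((+ 2) ^ (2 ℕ.* l ℕ.+ 1))
  where
  rewrite-as : ∀ s N → + 3 * N + s ≡ s + N * (1ℤ + + 2 * 1ℤ)
  rewrite-as = solve-∀

neg-repB-cls : ∀ l → - repB l ≡ cls l (- sgn l) (- + 2)
neg-repB-cls l = rewrite-as (sgn l) ((+ 2) ^ (2 ℕ.* l ℕ.+ 1))
  where
  rewrite-as : ∀ s N → - (+ 3 * N + s) ≡ - s + N * (1ℤ + + 2 * - + 2)
  rewrite-as = solve-∀

residues5 : List ℤ
residues5 = map +_ (upTo 5)

residue-mem : ∀ o → + (o % 5) ∈ residues5
residue-mem o = ∈-map⁺ +_ (∈-upTo⁺ (ℕDM.m%n<n o 5))

-- The class selected by the sign e, by s = (−1)^l and by the residue ρ of z mod 5: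
-- (s, 0) ↦ A, (s, 1) ↦ B, (−s, −1) ↦ −A, (−s, −2) ↦ −B.
ClassChoice : ℤ → ℤ → ℤ → Set
ClassChoice e s ρ = (e ≡ s × (ρ ≡ 0ℤ [mod 5 ] ⊎ ρ ≡ 1ℤ [mod 5 ]))
                  ⊎ (e ≡ - s × (ρ ≡ - 1ℤ [mod 5 ] ⊎ ρ ≡ - + 2 [mod 5 ]))

classChoice? : ∀ e s ρ → Dec (ClassChoice e s ρ)
classChoice? e s ρ =
  ((e ℤ.≟ s) ×-dec ((ρ ≡? 0ℤ [mod 5 ]) ⊎-dec (ρ ≡? 1ℤ [mod 5 ])))
  ⊎-dec ((e ℤ.≟ - s) ×-dec ((ρ ≡? - 1ℤ [mod 5 ]) ⊎-dec (ρ ≡? - + 2 [mod 5 ])))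

class-choice : ∀ {e s r ρ} → e ∈ signs → s ∈ signs → r ∈ uResidues → ρ ∈ residues5 →
               r ≡ e + s * + 2 * (1ℤ + + 2 * ρ) [mod 5 ] → ClassChoice e s ρ
class-choice e∈ s∈ r∈ ρ∈ = All.lookup (All.lookup (All.lookup (All.lookup table e∈) s∈) r∈) ρ∈
  where
  Claim : ℤ → ℤ → ℤ → ℤ → Set
  Claim e s r ρ = r ≡ e + s * + 2 * (1ℤ + + 2 * ρ) [mod 5 ] → ClassChoice e s ρ

  table : All (λ e → All (λ s → All (λ r → All (Claim e s r) residues5) uResidues) signs) signs
  table = toWitness {a? = all? (λ e → all? (λ s → all? (λ r → all? (λ ρ →
            (r ≡? e + s * + 2 * (1ℤ + + 2 * ρ) [mod 5 ]) →-dec classChoice? e s ρ)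
            residues5) uResidues) signs) signs} _

-- Part (1), forward residue step: u = cls l e o with u ≡ 3, 7 (mod 5) lies in
-- one of the four classes, because 2^(2l+1) ≡ 2·(−1)^l (mod 5).
classes-of-form : ∀ {u e r} l o → e ∈ signs → r ∈ uResidues → + u ≋[ 5 ] r →
                  + u ≡ cls l e (+ o) → InClasses u l
classes-of-form {u} {e} {r} l o e∈ r∈ u≋r u≡ =
  select (class-choice e∈ (sgn∈signs l) r∈ (residue-mem o) (unwrap reduced))
  where
  open ≋-Reasoning 5
  reduced : r ≋[ 5 ] e + sgn l * + 2 * (1ℤ + + 2 * + (o % 5))
  reduced = begin
    r                 ≈⟨ u≋r ⟨
    + u               ≡⟨ u≡ ⟩
    cls l e (+ o)     ≈⟨ ≋-+ˡ e (≋-* (odd-power-mod5 l (here refl) (≋-% 5 2))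
                                       (≋-+ˡ 1ℤ (≋-*ˡ (+ 2) (≋-% 5 o)))) ⟩
    e + sgn l * + 2 * (1ℤ + + 2 * + (o % 5)) ∎

  reach : ∀ {e′ X} c → e ≡ e′ → + (o % 5) ≡ c [mod 5 ] → X ≡ cls l e′ c → + u ≡ X [mod modulus l ]
  reach c refl ρ≡c X≡ = subst₂ (λ a b → a ≡ b [mod modulus l ]) (sym u≡) (sym X≡)
                             (cls-congruent l e {c = c} (≋-trans (≋-% 5 o) (mk≋ ρ≡c)))

  select : ClassChoice e (sgn l) (+ (o % 5)) → InClasses u l
  select (inj₁ (e≡s , inj₁ ρ≡0)) = inj₁ (inj₁ (reach 0ℤ e≡s ρ≡0 (repA-cls l)))
  select (inj₁ (e≡s , inj₂ ρ≡1)) = inj₂ (inj₁ (reach 1ℤ e≡s ρ≡1 (repB-cls l)))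
  select (inj₂ (e≡-s , inj₁ ρ≡-1)) = inj₁ (inj₂ (reach (- 1ℤ) e≡-s ρ≡-1 (neg-repA-cls l)))
  select (inj₂ (e≡-s , inj₂ ρ≡-2)) = inj₂ (inj₂ (reach (- + 2) e≡-s ρ≡-2 (neg-repB-cls l)))

as-cls : ∀ {u} l → InClasses u l → ∃ λ e → e ∈ signs × ∃ λ z → + u ≡ cls l e z
as-cls {u} l = pick
  where
  via : ∀ {X e} c → e ∈ signs → X ≡ cls l e c → + u ≡ X [mod modulus l ] →
        ∃ λ e → e ∈ signs × ∃ λ z → + u ≡ cls l e z
  via {e = e} c e∈ X≡ h = e , e∈ , cls-shift l e c (subst (λ X → + u ≡ X [mod modulus l ]) X≡ h)

  pick : InClasses u l → ∃ λ e → e ∈ signs × ∃ λ z → + u ≡ cls l e z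
  pick (inj₁ (inj₁ h)) = via 0ℤ (sgn∈signs l) (repA-cls l) h
  pick (inj₁ (inj₂ h)) = via (- 1ℤ) (sign-neg (sgn∈signs l)) (neg-repA-cls l) h
  pick (inj₂ (inj₁ h)) = via 1ℤ (sgn∈signs l) (repB-cls l) h
  pick (inj₂ (inj₂ h)) = via (- + 2) (sign-neg (sgn∈signs l)) (neg-repB-cls l) h

-- v₂ = j + 3 is even exactly when j + 2 = 2l + 1 with l ≥ 1.
odd-exponent : ∀ a → 2 ℕ.+ suc (2 ℕ.* a) ≡ 2 ℕ.* suc a ℕ.+ 1
odd-exponent = ℕSolver.solve-∀

even-exponent : ∀ a → 3 ℕ.+ suc (2 ℕ.* a) ≡ 2 ℕ.* suc (suc a)
even-exponent = ℕSolver.solve-∀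

part1-forward : ∀ {u} → 0 < u → u % 10 ≡ 3 ⊎ u % 10 ≡ 7 → ValEven 2 (u ℕ.* u ℕ.∸ 1) →
                ∃ λ l → 1 ≤ l × InClasses u l
part1-forward {u} u>0 h10 (k , v≡k , m , k≡2m) with near-sign {u} h10 | residue-mod5 {u} h10
... | e , e∈ , j , o , u≡ | r , r∈ , u≋r = by-parity (parity j)
  where
  3+j≡k : 3 ℕ.+ j ≡ k
  3+j≡k = hasVal-unique {2} {u ℕ.* u ℕ.∸ 1} (v₂-square-minus-one j (+ o) u>0 e∈ u≡) v≡k

  by-parity : IsEven j ⊎ IsOdd j → ∃ λ l → 1 ≤ l × InClasses u l
  by-parity (inj₁ (a , j≡2a)) = contradiction 2m≡odd (ℕP.even≢odd m (suc a))
    where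
    2m≡odd : 2 ℕ.* m ≡ suc (2 ℕ.* suc a)
    2m≡odd = trans (sym k≡2m) (trans (sym 3+j≡k)
                   (trans (cong (3 ℕ.+_) j≡2a) (cong suc (sym (double-suc a)))))
  by-parity (inj₂ (a , j≡1+2a)) = suc a , s≤s z≤n ,
    classes-of-form (suc a) o e∈ r∈ u≋r
      (trans u≡ (cong (λ t → e + (+ 2) ^ t * (1ℤ + + 2 * + o))
                      (trans (cong (2 ℕ.+_) j≡1+2a) (odd-exponent a))))

part1-backward : ∀ {u} → 0 < u → (∃ λ l → 1 ≤ l × InClasses u l) → ValEven 2 (u ℕ.* u ℕ.∸ 1)
part1-backward _ (zero , () , _)
part1-backward u>0 (suc a , _ , classes) with as-cls (suc a) classes
... | e , e∈ , z , u≡ = 3 ℕ.+ suc (2 ℕ.* a) ,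
  v₂-square-minus-one (suc (2 ℕ.* a)) z u>0 e∈
    (trans u≡ (cong (λ t → e + (+ 2) ^ t * (1ℤ + + 2 * z)) (sym (odd-exponent a)))) ,
  suc (suc a) , even-exponent a

-- Part (2)

even-with-odd-valuation : ∀ {p m} l → IsOdd p → 2 ∣ m → HasVal p m (suc (2 ℕ.* l)) →
                          ∃ λ b → + m ≡ + 2 * + b * (+ p) ^ (2 ℕ.* l ℕ.+ 1) × ¬ p ∣ b
even-with-odd-valuation {p} {m} l p-odd 2∣m hv with hasVal-elim {p} {m} {suc (2 ℕ.* l)} hv
... | c , m≡ , p∤c with euclidsLemma (p ℕ.^ suc (2 ℕ.* l)) c prime[2] (subst (2 ∣_) m≡ 2∣m)
...   | inj₁ 2∣pᵏ = contradiction 2∣pᵏ (2∤odd^ p-odd (suc (2 ℕ.* l)))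
...   | inj₂ (divides b c≡) = b , m≡2bq , λ p∣b → p∤c (subst (p ∣_) (sym c≡) (∣m⇒∣m*n 2 p∣b))
  where
  open ≡-Reasoning
  regroup : ∀ Q B → Q * (B * + 2) ≡ + 2 * B * Q
  regroup = solve-∀

  m≡2bq : + m ≡ + 2 * + b * (+ p) ^ (2 ℕ.* l ℕ.+ 1)
  m≡2bq = begin
    + m                                     ≡⟨ cong +_ (trans m≡ (cong (p ℕ.^ suc (2 ℕ.* l) ℕ.*_) c≡)) ⟩
    + (p ℕ.^ suc (2 ℕ.* l) ℕ.* (b ℕ.* 2))   ≡⟨ ℤP.pos-* (p ℕ.^ suc (2 ℕ.* l)) (b ℕ.* 2) ⟩
    + (p ℕ.^ suc (2 ℕ.* l)) * + (b ℕ.* 2)   ≡⟨ cong₂ _*_ (sym (pos-^ p (suc (2 ℕ.* l)))) (ℤP.pos-* b 2) ⟩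
    (+ p) ^ suc (2 ℕ.* l) * (+ b * + 2)     ≡⟨ cong (λ k → (+ p) ^ k * (+ b * + 2)) (ℕP.+-comm 1 (2 ℕ.* l)) ⟩
    (+ p) ^ (2 ℕ.* l ℕ.+ 1) * (+ b * + 2)   ≡⟨ regroup ((+ p) ^ (2 ℕ.* l ℕ.+ 1)) (+ b) ⟩
    + 2 * + b * (+ p) ^ (2 ℕ.* l ℕ.+ 1)     ∎

odd-valuation : ∀ {p m b} l → Prime p → IsOdd p → ¬ (+ p) ℤD.∣ b →
                + m ≡ (+ p) ^ (2 ℕ.* l ℕ.+ 1) * (+ 2 * b) → ValOdd p m
odd-valuation {p} {m} {b} l p-prime p-odd p∤b m≡ =
  2 ℕ.* l ℕ.+ 1 ,
  hasVal-introℤ p (2 ℕ.* l ℕ.+ 1) {m} {+ 2 * b} {{prime⇒nonZero p-prime}} m≡ (odd-prime∤2b {p} {b} p-prime p-odd p∤b) ,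
  l , ℕP.+-comm (2 ℕ.* l) 1

Clause : ℕ → ℕ → ℤ → ℤ → ℤ → Set
Clause π π₀ b x y = π ≡ π₀ → b ≡ x [mod 5 ] ⊎ b ≡ y [mod 5 ]

clause? : ∀ π π₀ b x y → Dec (Clause π π₀ b x y)
clause? π π₀ b x y = (π ℕ.≟ π₀) →-dec ((b ≡? x [mod 5 ]) ⊎-dec (b ≡? y [mod 5 ]))

PlusConditions MinusConditions : ℕ → ℤ → ℤ → Set
PlusConditions π s b =
  Clause π 4 b (+ 2) (+ 4) × Clause π 3 b s (s * + 2) × Clause π 2 b (s * + 3) (s * + 4)
MinusConditions π s b =
  Clause π 4 b (+ 1) (+ 3) × Clause π 3 b (s * + 3) (s * + 4) × Clause π 2 b s (s * + 2)

clause-resp : ∀ {π π₀ b β x y} → b ≋[ 5 ] β → Clause π π₀ β x y → Clause π π₀ b x y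
clause-resp {b = b} {β} b≋β clause π≡π₀ = map⊎ move move (clause π≡π₀)
  where
  move : ∀ {x} → β ≡ x [mod 5 ] → b ≡ x [mod 5 ]
  move β≡x = unwrap (≋-trans b≋β (mk≋ β≡x))

plus-resp : ∀ {π s b β} → b ≋[ 5 ] β → PlusConditions π s β → PlusConditions π s b
plus-resp b≋β (c₄ , c₃ , c₂) = clause-resp b≋β c₄ , clause-resp b≋β c₃ , clause-resp b≋β c₂

minus-resp : ∀ {π s b β} → b ≋[ 5 ] β → MinusConditions π s β → MinusConditions π s b
minus-resp b≋β (c₄ , c₃ , c₂) = clause-resp b≋β c₄ , clause-resp b≋β c₃ , clause-resp b≋β c₂

ResidueConditions : ℤ → ℕ → ℤ → ℤ → Set
ResidueConditions r π s β =
  (r ≡ + 2 * β * oddPowRes π s + 1ℤ [mod 5 ] → PlusConditions π s β) ×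
  (r ≡ + 2 * β * oddPowRes π s - 1ℤ [mod 5 ] → MinusConditions π s β)

residue-conditions : ∀ {r π s β} → r ∈ uResidues → π ∈ πs → s ∈ signs → β ∈ residues5 →
                     ResidueConditions r π s β
residue-conditions r∈ π∈ s∈ β∈ = All.lookup (All.lookup (All.lookup (All.lookup table r∈) π∈) s∈) β∈
  where
  decide : ∀ r π s β → Dec (ResidueConditions r π s β)
  decide r π s β =
    ((r ≡? + 2 * β * oddPowRes π s + 1ℤ [mod 5 ]) →-dec
       (clause? π 4 β (+ 2) (+ 4) ×-dec clause? π 3 β s (s * + 2) ×-dec clause? π 2 β (s * + 3) (s * + 4)))
    ×-dec
    ((r ≡? + 2 * β * oddPowRes π s - 1ℤ [mod 5 ]) →-dec
       (clause? π 4 β (+ 1) (+ 3) ×-dec clause? π 3 β (s * + 3) (s * + 4) ×-dec clause? π 2 β s (s * + 2)))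

  table : All (λ r → All (λ π → All (λ s → All (ResidueConditions r π s) residues5) signs) πs) uResidues
  table = toWitness {a? = all? (λ r → all? (λ π → all? (λ s → all? (decide r π s)
                                residues5) signs) πs) uResidues} _

reduce-mod5 : ∀ {u r p b δ} l → p % 5 ∈ πs → + u ≋[ 5 ] r →
              + u ≡ + 2 * + b * (+ p) ^ (2 ℕ.* l ℕ.+ 1) + δ →
              r ≋[ 5 ] + 2 * + (b % 5) * oddPowRes (p % 5) (sgn l) + δ
reduce-mod5 {u} {r} {p} {b} {δ} l π∈ u≋r u≡ = begin
  r                                              ≈⟨ u≋r ⟨
  + u                                            ≡⟨ u≡ ⟩
  + 2 * + b * (+ p) ^ (2 ℕ.* l ℕ.+ 1) + δ        ≈⟨ ≋-+ʳ δ (≋-* (≋-*ˡ (+ 2) (≋-% 5 b))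
                                                                  (odd-power-mod5 l π∈ (≋-% 5 p))) ⟩
  + 2 * + (b % 5) * oddPowRes (p % 5) (sgn l) + δ ∎
  where open ≋-Reasoning 5

Representation : ℕ → ℕ → Set
Representation u p = ∃ λ l → ∃ λ b → ¬ (+ p) ℤD.∣ b ×
  ((+ u ≡ + 2 * b * (+ p) ^ (2 ℕ.* l ℕ.+ 1) + 1ℤ × PlusConditions (p % 5) (sgn l) b)
   ⊎ (+ u ≡ + 2 * b * (+ p) ^ (2 ℕ.* l ℕ.+ 1) - 1ℤ × MinusConditions (p % 5) (sgn l) b))

π∈πs : ∀ {p} → p % 5 ≡ 2 ⊎ p % 5 ≡ 3 ⊎ p % 5 ≡ 4 → p % 5 ∈ πs
π∈πs (inj₁ p≡2) = here p≡2
π∈πs (inj₂ (inj₁ p≡3)) = there (here p≡3)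
π∈πs (inj₂ (inj₂ p≡4)) = there (there (here p≡4))

part2-forward : ∀ {u p} → u % 10 ≡ 3 ⊎ u % 10 ≡ 7 → IsOdd p →
                p % 5 ≡ 2 ⊎ p % 5 ≡ 3 ⊎ p % 5 ≡ 4 →
                ValOdd p (u ℕ.+ 1) ⊎ ValOdd p (u ℕ.∸ 1) → Representation u p
part2-forward {u} {p} h10 p-odd p-res with odd-of-residue {u} h10 | residue-mod5 {u} h10
... | m , _ , refl | r , r∈ , u≋r = from
  where
  π∈ : p % 5 ∈ πs
  π∈ = π∈πs {p} p-res

  conditions : ∀ l b → ResidueConditions r (p % 5) (sgn l) (+ (b % 5))
  conditions l b = residue-conditions r∈ π∈ (sgn∈signs l) (residue-mem b)

  odd+1 : ∀ m → suc (2 ℕ.* m) ℕ.+ 1 ≡ suc m ℕ.* 2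
  odd+1 = ℕSolver.solve-∀

  from : ValOdd p (suc (2 ℕ.* m) ℕ.+ 1) ⊎ ValOdd p (2 ℕ.* m) → Representation (suc (2 ℕ.* m)) p
  from (inj₂ (_ , hv , l , refl)) with even-with-odd-valuation l p-odd (divides m (ℕP.*-comm 2 m)) hv
  ... | b , u-1≡ , p∤b = l , + b , p∤b ,
    inj₁ (u≡ , plus-resp {p % 5} {sgn l} (≋-% 5 b) (proj₁ (conditions l b) (unwrap (reduce-mod5 {p = p} {b} l π∈ u≋r u≡))))
    where
    u≡ : + suc (2 ℕ.* m) ≡ + 2 * + b * (+ p) ^ (2 ℕ.* l ℕ.+ 1) + 1ℤ
    u≡ = trans (pos-suc (2 ℕ.* m)) (cong (_+ 1ℤ) u-1≡)
  from (inj₁ (_ , hv , l , refl)) with even-with-odd-valuation l p-odd (divides (suc m) (odd+1 m)) hv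
  ... | b , u+1≡ , p∤b = l , + b , p∤b ,
    inj₂ (u≡ , minus-resp {p % 5} {sgn l} (≋-% 5 b) (proj₂ (conditions l b) (unwrap (reduce-mod5 {p = p} {b} l π∈ u≋r u≡))))
    where
    cancel : ∀ x → x ≡ x + 1ℤ - 1ℤ
    cancel = solve-∀
    u≡ : + suc (2 ℕ.* m) ≡ + 2 * + b * (+ p) ^ (2 ℕ.* l ℕ.+ 1) - 1ℤ
    u≡ = trans (cancel _) (cong (_- 1ℤ) (trans (sym (ℤP.pos-+ (suc (2 ℕ.* m)) 1)) u+1≡))

part2-backward : ∀ {u p} → 0 < u → Prime p → IsOdd p → Representation u p →
                 ValOdd p (u ℕ.+ 1) ⊎ ValOdd p (u ℕ.∸ 1)
part2-backward {zero} () _ _ _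
part2-backward {suc u} {p} _ p-prime p-odd (l , b , p∤b , inj₁ (u≡ , _)) =
  inj₂ (odd-valuation {p} {u} {b} l p-prime p-odd p∤b (trans (cong (_- 1ℤ) u≡) (regroup b _)))
  where
  regroup : ∀ b Q → + 2 * b * Q + 1ℤ - 1ℤ ≡ Q * (+ 2 * b)
  regroup = solve-∀
part2-backward {suc u} {p} _ p-prime p-odd (l , b , p∤b , inj₂ (u≡ , _)) =
  inj₁ (odd-valuation {p} {suc u ℕ.+ 1} {b} l p-prime p-odd p∤b
          (trans (ℤP.pos-+ (suc u) 1) (trans (cong (_+ 1ℤ) u≡) (regroup b _))))
  where
  regroup : ∀ b Q → + 2 * b * Q - 1ℤ + 1ℤ ≡ Q * (+ 2 * b)
  regroup = solve-∀

lemma2p6 : (u : ℕ) → 0 ℕ.< u → (u % 10 ≡ 3 ⊎ u % 10 ≡ 7) →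
  (ValEven 2 (u ℕ.* u ℕ.∸ 1)
    ⇔ (∃ λ (l : ℕ) → 1 ≤ l ×
        let s = (- ℤ.1ℤ) ℤ.^ l
            M = 5 ℕ.* 2 ℕ.^ (2 ℕ.* l ℕ.+ 2)
            A = (+ 2) ℤ.^ (2 ℕ.* l ℕ.+ 1) ℤ.+ s
            B = (+ 3) ℤ.* (+ 2) ℤ.^ (2 ℕ.* l ℕ.+ 1) ℤ.+ s
        in ((+ u) ≡ A [mod M ] ⊎ (+ u) ≡ - A [mod M ])
           ⊎ ((+ u) ≡ B [mod M ] ⊎ (+ u) ≡ - B [mod M ])))
  ×
  ((∃ λ (p : ℕ) → Prime p × IsOdd p × (p % 5 ≡ 2 ⊎ p % 5 ≡ 3 ⊎ p % 5 ≡ 4)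
      × (ValOdd p (u ℕ.+ 1) ⊎ ValOdd p (u ℕ.∸ 1)))
    ⇔ (∃ λ (p : ℕ) → Prime p × IsOdd p × (p % 5 ≡ 2 ⊎ p % 5 ≡ 3 ⊎ p % 5 ≡ 4)
        × ∃ λ (l : ℕ) → ∃ λ (b : ℤ) → ¬ ((+ p) ℤD.∣ b) ×
        let s = (- ℤ.1ℤ) ℤ.^ l
            q = (+ p) ℤ.^ (2 ℕ.* l ℕ.+ 1)
        in (((+ u) ≡ (+ 2) ℤ.* b ℤ.* q ℤ.+ ℤ.1ℤ)
             × (p % 5 ≡ 4 → b ≡ + 2 [mod 5 ] ⊎ b ≡ + 4 [mod 5 ])
             × (p % 5 ≡ 3 → b ≡ s [mod 5 ] ⊎ b ≡ s ℤ.* (+ 2) [mod 5 ])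
             × (p % 5 ≡ 2 → b ≡ s ℤ.* (+ 3) [mod 5 ] ⊎ b ≡ s ℤ.* (+ 4) [mod 5 ]))
           ⊎
           (((+ u) ≡ (+ 2) ℤ.* b ℤ.* q ℤ.- ℤ.1ℤ)
             × (p % 5 ≡ 4 → b ≡ + 1 [mod 5 ] ⊎ b ≡ + 3 [mod 5 ])
             × (p % 5 ≡ 3 → b ≡ s ℤ.* (+ 3) [mod 5 ] ⊎ b ≡ s ℤ.* (+ 4) [mod 5 ])
             × (p % 5 ≡ 2 → b ≡ s [mod 5 ] ⊎ b ≡ s ℤ.* (+ 2) [mod 5 ]))))
lemma2p6 u u>0 h10 =
  mk⇔ (part1-forward u>0 h10) (part1-backward u>0) ,
  mk⇔ (λ { (p , p-prime , p-odd , p-res , v) →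
             p , p-prime , p-odd , p-res , part2-forward h10 p-odd p-res v })
      (λ { (p , p-prime , p-odd , p-res , rep) →
             p , p-prime , p-odd , p-res , part2-backward u>0 p-prime p-odd rep })
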